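{- Let $S, S', T, T'$ be statements and $B$ a Boolean program expression, with types such that all the expressions below are well-typed and partial refinement applies (exceptional state space equal to initial state space). Then: (i) if $S \precsim S'$ then $S;T \precsim S';T$; (ii) if $S \precsim S'$ and $T \precsim T'$ then $S \sqcap T \precsim S' \sqcap T'$ and $\mathsf{if}\ B\ \mathsf{then}\ S\ \mathsf{else}\ T \precsim \mathsf{if}\ B\ \mathsf{then}\ S'\ \mathsf{else}\ T'$.
   Context: A state predicate on a state space is a function to $Bool$; logical operations are pointwise and $u\le v$ iff $\forall\sigma.\ u\,\sigma\Rightarrow v\,\sigma$. A predicate transformer of type $\mathcal P\Psi\times\mathcal P\Omega\to\mathcal P\Delta$ maps a normal postcondition on $\Psi$ and an exceptional postcondition on $\Omega$ to a precondition on $\Delta$; a statement is a monotonic one ($q\le q'$, $r\le r'$ imply $S(q,r)\le S(q',r')$). Definitions: $\mathsf{raise}(q,r)=r$, $(S;T)(q,r)=S(T(q,r),r)$, $(S\sqcap T)(q,r)=S(q,r)\wedge T(q,r)$, $[u,v](q,r)=(u\Rightarrow q)\wedge(v\Rightarrow r)$, $[u](q,r)=(u\Rightarrow q)$. A Boolean program expression $B$ has a definedness predicate $\mathsf{def}\,B$ and value predicate $\mathsf{val}\,B$; $\mathsf{if}\ B\ \mathsf{then}\ S\ \mathsf{else}\ T = [\mathsf{def}\,B,\neg\mathsf{def}\,B];(([\mathsf{val}\,B];S)\sqcap([\neg\mathsf{val}\,B];T))$. Total refinement $S\sqsubseteq T$ iff $\forall q,r.\ S(q,r)\le T(q,r)$.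 Partial refinement (for transformers whose exceptional state space equals their initial state space): $S\precsim T \;\widehat=\; S\sqcap\mathsf{raise}\sqsubseteq T$. -}

module Defs where

open import Data.Bool using (Bool; true; false; _∧_; not; T)

open import Level using (Level; suc; _⊔_)

Pred : Set → Set
Pred Σ = Σ → Bool

_⊓ₚ_ : {Σ : Set} → Pred Σ → Pred Σ → Pred Σ
(u ⊓ₚ v) σ = u σ ∧ v σ

¬ₚ_ : {Σ : Set} → Pred Σ → Pred Σ
(¬ₚ u) σ = not (u σ)

_⇒ₚ_ : {Σ : Set} → Pred Σ → Pred Σ → Pred Σ
(u ⇒ₚ v) σ with u σ
... | true  = v σ
... | false = true

_≤ₚ_ : {Σ : Set} → Pred Σ → Pred Σ → Set
u ≤ₚ v = ∀ σ → T (u σ) → T (v σ)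

PT : Set → Set → Set → Set
PT Ψ Ω Δ = Pred Ψ → Pred Ω → Pred Δ

Monotonic : {Ψ Ω Δ : Set} → PT Ψ Ω Δ → Set
Monotonic {Ψ} {Ω} {Δ} S =
  ∀ (q q' : Pred Ψ) (r r' : Pred Ω) → q ≤ₚ q' → r ≤ₚ r' → S q r ≤ₚ S q' r'

record Stmt (Ψ Ω Δ : Set) : Set₁ where
  constructor stmt
  field
    tr   : PT Ψ Ω Δ
    mono : Monotonic tr
open Stmt public

raise : {Ψ Ω : Set} → PT Ψ Ω Ω
raise q r = r

_⨾_ : {Ψ Φ Ω Δ : Set} → PT Ψ Ω Δ → PT Φ Ω Ψ → PT Φ Ω Δ
(S ⨾ T) q r = S (T q r) r

_⊓_ : {Ψ Ω Δ : Set} → PT Ψ Ω Δ → PT Ψ Ω Δ → PT Ψ Ω Δ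
(S ⊓ T) q r = S q r ⊓ₚ T q r

[_∥_] : {Δ : Set} → Pred Δ → Pred Δ → PT Δ Δ Δ
[ u ∥ v ] q r = (u ⇒ₚ q) ⊓ₚ (v ⇒ₚ r)

[_] : {Δ Ω : Set} → Pred Δ → PT Δ Ω Δ
[ u ] q r = u ⇒ₚ q

record BoolExpr (Δ : Set) : Set where
  constructor boolExpr
  field
    def : Pred Δ
    val : Pred Δ
open BoolExpr public

if_then_else_ : {Ψ Δ : Set} → BoolExpr Δ → PT Ψ Δ Δ → PT Ψ Δ Δ → PT Ψ Δ Δ
if B then S else T =
  [ def B ∥ ¬ₚ def B ] ⨾ (([ val B ] ⨾ S) ⊓ ([ ¬ₚ val B ] ⨾ T))

_⊑_ : {Ψ Ω Δ : Set} → PT Ψ Ω Δ → PT Ψ Ω Δ → Set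
_⊑_ {Ψ} {Ω} S T = ∀ (q : Pred Ψ) (r : Pred Ω) → S q r ≤ₚ T q r

_≾_ : {Ψ Δ : Set} → PT Ψ Δ Δ → PT Ψ Δ Δ → Set
S ≾ T = (S ⊓ raise) ⊑ T

-- Partial refinement S ≾ S' says S (q , r) ∧ r ≤ S' (q , r): the refined statement need only
-- be correct where the exceptional postcondition r already holds.  Every construct in the
-- theorem passes r unchanged to its components, so this extra conjunct r can be pushed inward,
-- and the guards [u] and [u , v] only weaken their normal postcondition under an implication.
module Submission where

open import Data.Bool using (T; true; false; _∧_)
open import Data.Bool.Properties using (T-∧)
open import Data.Product using (_×_; _,_)
open import Function.Bundles using (Equivalence)
open import Defs

private
  variable
    Ψ Φ Δ : Set

-- The Boolean arguments are explicit: Agda cannot invert _∧_ or T to infer them.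
T-∧⁻ : ∀ x y → T (x ∧ y) → T x × T y
T-∧⁻ x y = Equivalence.to (T-∧ {x} {y})

T-∧⁺ : ∀ x y → T x → T y → T (x ∧ y)
T-∧⁺ x y Tx Ty = Equivalence.from (T-∧ {x} {y}) (Tx , Ty)

⇒ₚ-weakenʳ : (u p p' : Pred Δ) (σ : Δ) →
  (T (u σ) → T (p σ) → T (p' σ)) → T ((u ⇒ₚ p) σ) → T ((u ⇒ₚ p') σ)
⇒ₚ-weakenʳ u p p' σ f h with u σ
... | true  = f _ h
... | false = _

≾-intro : {S S' : PT Ψ Δ Δ} →
  (∀ q r σ → T (S q r σ) → T (r σ) → T (S' q r σ)) → S ≾ S'
≾-intro {S = S} f q r σ h with T-∧⁻ (S q r σ) (r σ) h
... | Sσ , rσ = f q r σ Sσ rσ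

≾-elim : {S S' : PT Ψ Δ Δ} → S ≾ S' →
  ∀ q r σ → T (S q r σ) → T (r σ) → T (S' q r σ)
≾-elim {S = S} S≾S' q r σ Sσ rσ = S≾S' q r σ (T-∧⁺ (S q r σ) (r σ) Sσ rσ)

≾-⨾ʳ : {S S' : PT Ψ Δ Δ} (T : PT Φ Δ Ψ) → S ≾ S' → (S ⨾ T) ≾ (S' ⨾ T)
≾-⨾ʳ T S≾S' q r = S≾S' (T q r) r

≾-⊓ : {S S' T T' : PT Ψ Δ Δ} → S ≾ S' → T ≾ T' → (S ⊓ T) ≾ (S' ⊓ T')
≾-⊓ {S = S} {S'} {T} {T'} S≾S' T≾T' = ≾-intro λ q r σ STσ rσ →
  let Sσ , Tσ = T-∧⁻ (S q r σ) (T q r σ) STσ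
  in  T-∧⁺ (S' q r σ) (T' q r σ) (≾-elim S≾S' q r σ Sσ rσ) (≾-elim T≾T' q r σ Tσ rσ)

[]-⨾-≾ : (u : Pred Δ) {S S' : PT Ψ Δ Δ} → S ≾ S' → ([ u ] ⨾ S) ≾ ([ u ] ⨾ S')
[]-⨾-≾ u {S} {S'} S≾S' = ≾-intro λ q r σ uSσ rσ →
  ⇒ₚ-weakenʳ u (S q r) (S' q r) σ (λ _ Sσ → ≾-elim S≾S' q r σ Sσ rσ) uSσ

[∥]-⨾-≾ : (u v : Pred Δ) {S S' : PT Ψ Δ Δ} → S ≾ S' →
  ([ u ∥ v ] ⨾ S) ≾ ([ u ∥ v ] ⨾ S')
[∥]-⨾-≾ u v {S} {S'} S≾S' = ≾-intro λ q r σ guardσ rσ →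
  let uSσ , vrσ = T-∧⁻ ((u ⇒ₚ S q r) σ) ((v ⇒ₚ r) σ) guardσ
  in  T-∧⁺ ((u ⇒ₚ S' q r) σ) ((v ⇒ₚ r) σ) (≾-elim ([]-⨾-≾ u S≾S') q r σ uSσ rσ) vrσ

≾-if : (B : BoolExpr Δ) {S S' T T' : PT Ψ Δ Δ} → S ≾ S' → T ≾ T' →
  (if B then S else T) ≾ (if B then S' else T')
≾-if B S≾S' T≾T' =
  [∥]-⨾-≾ (def B) (¬ₚ def B) (≾-⊓ ([]-⨾-≾ (val B) S≾S') ([]-⨾-≾ (¬ₚ val B) T≾T'))

theorem8 : {Ψ Φ Δ : Set} →
    ((S S' : Stmt Ψ Δ Δ) (T : Stmt Φ Δ Ψ) →
      tr S ≾ tr S' → (tr S ⨾ tr T) ≾ (tr S' ⨾ tr T))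
    × ((S S' T T' : Stmt Ψ Δ Δ) (B : BoolExpr Δ) →
      tr S ≾ tr S' → tr T ≾ tr T' →
      ((tr S ⊓ tr T) ≾ (tr S' ⊓ tr T'))
      × ((if B then tr S else tr T) ≾ (if B then tr S' else tr T')))
theorem8 =
  (λ S S' T → ≾-⨾ʳ (tr T)) ,
  (λ S S' T T' B S≾S' T≾T' → ≾-⊓ S≾S' T≾T' , ≾-if B S≾S' T≾T')
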